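{- Let $a,b$ be coprime positive integers and fix $k$ with $0\le k<b$. (a) For each path $P\in\mathcal{P}$, there is exactly one $k$-skeletal path $Q$ such that $Q=P_v$ for some lattice point $v$ on $P$. (b) The number of $k$-skeletal paths in $\mathcal{P}$ is $\frac{1}{a+b}\binom{a+b}{a}$. (c) For each labeled path $Q$ from $(0,0)$ to $(a,b)$ whose last step is an east step, there is exactly one cyclic shift of $Q$ (as a sequence of east steps and labeled north steps) that is a $k$-skeletal labeled path. (d) The number of $k$-skeletal labeled paths is $a^{b-1}$.
   Context: Let $\mathcal{P}$ be the set of lattice paths from $(0,0)$ to $(a,b)$ consisting of $b$ unit north steps and $a$ unit east steps. The level of a lattice point $(x,y)$ is $ay-bx$. For $Q\in\mathcal{P}$ and a lattice point $v$ on $Q$, the cyclic shift $Q_v$ is the path starting at the origin whose steps are the steps of $Q$ from $v$ to $(a,b)$ followed by the steps of $Q$ from $(0,0)$ to $v$. For $0\le k<b$, a path $Q\in\mathcal{P}$ is $k$-skeletal if (R1) the last $k+1$ north steps of $Q$ start at points of level $\ge 0$ (on or above the line $bx=ay$), and (R2) for every lattice point $v$ on $Q$ of level $>0$, condition (R1) fails for $Q_v$. A labeled path is a path in $\mathcal{P}$ together with a bijective assignment of the labels $1,\dots,b$ to its north steps such that, within each maximal run of consecutive north steps, labels increase from bottom to top. A labeled path is $k$-skeletal if its underlying unlabeled path is. When cyclically shifting a labeled path, labels move with their north steps. -}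

module Defs where

open import Data.Nat using (ℕ; zero; suc; _+_; _≤_; _<_)
open import Data.Integer as ℤ using (ℤ; +_)
open import Data.List using (List; []; _∷_; _++_; take; drop; map; upTo; length)
open import Data.List.Relation.Binary.Permutation.Propositional using (_↭_)
open import Data.List.Relation.Unary.Unique.Propositional using (Unique)
open import Data.List.Membership.Propositional using (_∈_)
open import Data.Product using (Σ; ∃; _×_; _,_)
open import Relation.Binary.PropositionalEquality using (_≡_)
open import Relation.Nullary using (¬_)
open import Function.Bundles using (_⇔_)

data Step : Set where
  E N : Step

#E : List Step → ℕ
#E []       = 0
#E (E ∷ s) = suc (#E s)
#E (N ∷ s) = #E s

#N : List Step → ℕ
#N []       = 0
#N (E ∷ s) = #N s
#N (N ∷ s) = suc (#N s)

-- Q ∈ 𝒫(a,b): a path from (0,0) to (a,b) with a east and b north steps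
IsPath : ℕ → ℕ → List Step → Set
IsPath a b Q = #E Q ≡ a × #N Q ≡ b

level : ℕ → ℕ → ℕ → ℕ → ℤ
level a b x y = (+ a) ℤ.* (+ y) ℤ.- (+ b) ℤ.* (+ x)

-- level of the i-th lattice point on Q (the point reached after the first i steps)
levelAt : ℕ → ℕ → List Step → ℕ → ℤ
levelAt a b Q i = level a b (#E (take i Q)) (#N (take i Q))

-- cyclic shift Q_v, where v is the lattice point after the first i steps (0 ≤ i ≤ |Q|)
rotate : {A : Set} → ℕ → List A → List A
rotate i Q = drop i Q ++ take i Q

-- (R1): the last k+1 north steps of Q start at points of level ≥ 0.
-- The step at position j (0-based) is a north step that is among the last k+1
-- north steps iff it is N and at most k north steps come after it; it starts
-- at the j-th lattice point of Q.
R1 : ℕ → ℕ → ℕ → List Step → Set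
R1 a b k Q = ∀ j → take 1 (drop j Q) ≡ N ∷ [] → #N (drop (suc j) Q) ≤ k →
             + 0 ℤ.≤ levelAt a b Q j

R2 : ℕ → ℕ → ℕ → List Step → Set
R2 a b k Q = ∀ i → i ≤ length Q → + 0 ℤ.< levelAt a b Q i → ¬ R1 a b k (rotate i Q)

Skeletal : ℕ → ℕ → ℕ → List Step → Set
Skeletal a b k Q = R1 a b k Q × R2 a b k Q

data LStep : Set where
  east  : LStep
  north : ℕ → LStep

underlying : List LStep → List Step
underlying []            = []
underlying (east ∷ s)    = E ∷ underlying s
underlying (north _ ∷ s) = N ∷ underlying s

labels : List LStep → List ℕ
labels []            = []
labels (east ∷ s)    = labels s
labels (north l ∷ s) = l ∷ labels s

-- A labeled path from (0,0) to (a,b): the underlying path is in 𝒫, the labels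
-- of the north steps are a permutation of 1,…,b, and within each maximal run of
-- consecutive north steps labels increase from bottom to top (equivalently, any
-- two consecutive north steps have increasing labels).
IsLabeledPath : ℕ → ℕ → List LStep → Set
IsLabeledPath a b Q =
  IsPath a b (underlying Q) ×
  labels Q ↭ map suc (upTo b) ×
  (∀ i l l' → take 2 (drop i Q) ≡ north l ∷ north l' ∷ [] → l < l')

SkeletalLabeled : ℕ → ℕ → ℕ → List LStep → Set
SkeletalLabeled a b k Q = IsLabeledPath a b Q × Skeletal a b k (underlying Q)

IsShiftOf : {A : Set} → List A → List A → Set
IsShiftOf Q P = Σ ℕ λ i → i ≤ length P × Q ≡ rotate i P

∃! : {A : Set} → (A → Set) → Set
∃! {A} P = Σ A λ x → P x × (∀ y → P y → y ≡ x)

HasCount : {A : Set} → (A → Set) → ℕ → Set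
HasCount {A} P n = Σ (List A) λ L → Unique L × (∀ x → (x ∈ L) ⇔ P x) × length L ≡ n

-- Let P ∈ 𝒫 have n = a + b steps and write L w for the level of its w-th lattice point. The i-th
-- point of the shift P_w has level L (w + i) - L w (indices mod n), and since gcd(a, b) = 1 the
-- levels L 0, …, L (n - 1) are pairwise distinct. Hence P_w satisfies (R1) when L w is minimal, and
-- P_w is k-skeletal exactly when L w is maximal among the w for which P_w satisfies (R1), because a
-- point of positive level on P_w is a point of larger level on P. This w is unique, which gives (a);
-- it follows that the n shifts of P are pairwise distinct, so 𝒫 splits into orbits of size a + b,
-- each containing one k-skeletal path, which gives (b). A k-skeletal path ends with an east step,
-- and cutting a labeled path just after an east step keeps its runs of north steps intact, which
-- gives (c). The labeled paths ending with an east step arise uniquely by inserting north steps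
-- labeled 1, …, b in turn, each just before one of the a east steps, so there are a ^ b of them,
-- and each k-skeletal labeled path has exactly a cyclic shifts among them (one cut after each of its
-- east steps), which gives (d).

module Submission where

open import Defs

open import Algebra.Bundles using (AbelianGroup)
open import Data.Empty using (⊥; ⊥-elim)
open import Data.Integer as ℤ using (ℤ; 0ℤ)
import Data.Integer.Properties as ℤ
open import Algebra.Properties.Group (AbelianGroup.group ℤ.+-0-abelianGroup) using (identityʳ-unique)
import Data.Integer.Tactic.RingSolver as ℤ-Solver
open import Data.List
  using (List; []; _∷_; _++_; take; drop; length; upTo; filter; map; cartesianProduct; last; head; replicate;
         initLast; _∷ʳ′_)
import Data.List.Extrema ℤ.≤-totalOrder as ℤ-Extrema
open import Data.List.Membership.Propositional using (_∈_; _∉_)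
open import Data.List.Membership.Propositional.Properties
  using (∈-upTo⁺; ∈-upTo⁻; ∈-filter⁺; ∈-filter⁻; ∈-map⁺; ∈-map⁻; ∈-++⁺ˡ; ∈-++⁺ʳ; ∈-++⁻;
         ∈-cartesianProduct⁺; ∈-cartesianProduct⁻)
open import Data.List.Membership.Propositional.Properties.WithK using (unique∧set⇒bag)
open import Data.List.Properties
  using (take++drop≡id; length-take; length-++; length-map; length-upTo; ++-assoc; ++-identityʳ; ∷-injective; ∷-injectiveʳ;
         map-++; take-map; drop-map; last-map; upTo-∷ʳ; ≡-dec)
open import Data.List.Relation.Binary.BagAndSetEquality using (∼bag⇒↭)
open import Data.List.Relation.Binary.Permutation.Propositional
  using (_↭_; ↭-trans; ↭-sym; ↭-reflexive; prep; module PermutationReasoning)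
import Data.List.Relation.Binary.Permutation.Propositional.Properties as ↭
open import Data.List.Relation.Unary.All as All using (All)
open import Data.List.Relation.Unary.All.Properties using (all-upTo) renaming (map⁺ to All-map⁺)
open import Data.List.Relation.Unary.AllPairs using ([]; _∷_)
open import Data.List.Relation.Unary.Any using (here; there)
open import Data.List.Relation.Unary.Linked as Linked using (Linked; []; [-]; _∷_)
import Data.List.Relation.Unary.Linked.Properties as Linked
open import Data.List.Relation.Unary.Unique.Propositional using (Unique)
import Data.List.Relation.Unary.Unique.Propositional.Properties as Unique
open import Data.Maybe using (just; nothing)
import Data.Maybe as Maybe
open import Data.Maybe.Relation.Binary.Connected using (Connected; just; just-nothing; nothing-just; nothing)
open import Data.Nat using (ℕ; zero; suc; _+_; _*_; _∸_; _^_; _<_; _≤_; _≤?_; _<?_; z≤n; s≤s; >-nonZero)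
open import Data.Nat.Combinatorics using (_C_; nCn≡1; nCk+nC[k+1]≡[n+1]C[k+1])
open import Data.Nat.Coprimality using (Coprime; coprime-divisor)
open import Data.Nat.Divisibility using (divides; >⇒∤)
import Data.Nat.Properties as ℕ
open import Data.Nat.Tactic.RingSolver using (solve-∀)
open import Data.Product using (Σ; ∃-syntax; _×_; _,_; proj₁; proj₂; uncurry)
import Data.Product as Product
open import Data.Product.Properties using (×-≡,≡→≡)
open import Data.Sum using (_⊎_; inj₁; inj₂)
open import Data.Unit using (⊤; tt)
open import Function.Base using (_∘_)
open import Function.Bundles using (_⇔_; mk⇔; Equivalence)
open import Relation.Binary.Definitions using (tri<; tri≈; tri>)
open import Relation.Binary.PropositionalEquality
  using (_≡_; _≢_; refl; sym; trans; cong; cong₂; subst; module ≡-Reasoning)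
open import Relation.Nullary using (¬_; Dec; yes; no; contradiction)
open import Relation.Nullary.Decidable using (map′; _×-dec_; _→-dec_; ¬?)

-- Cyclic shifts of lists

module _ {A : Set} where

  take-length-++ : (xs ys : List A) → take (length xs) (xs ++ ys) ≡ xs
  take-length-++ []       ys = refl
  take-length-++ (x ∷ xs) ys = cong (x ∷_) (take-length-++ xs ys)

  drop-length-++ : (xs ys : List A) → drop (length xs) (xs ++ ys) ≡ ys
  drop-length-++ []       ys = refl
  drop-length-++ (x ∷ xs) ys = drop-length-++ xs ys

  rotate-length-++ : (xs ys : List A) → rotate (length xs) (xs ++ ys) ≡ ys ++ xs
  rotate-length-++ xs ys rewrite drop-length-++ xs ys | take-length-++ xs ys = refl

  rotate-zero : (xs : List A) → rotate 0 xs ≡ xs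
  rotate-zero = ++-identityʳ

  rotate-preserves-sum : (f : List A → ℕ) → (∀ xs ys → f (xs ++ ys) ≡ f xs + f ys) →
                         ∀ i xs → f (rotate i xs) ≡ f xs
  rotate-preserves-sum f f-++ i xs = begin
    f (drop i xs ++ take i xs)        ≡⟨ f-++ (drop i xs) (take i xs) ⟩
    f (drop i xs) + f (take i xs)     ≡⟨ ℕ.+-comm (f (drop i xs)) (f (take i xs)) ⟩
    f (take i xs) + f (drop i xs)     ≡⟨ f-++ (take i xs) (drop i xs) ⟨
    f (take i xs ++ drop i xs)        ≡⟨ cong f (take++drop≡id i xs) ⟩
    f xs                              ∎
    where open ≡-Reasoning

  length-rotate : ∀ i (xs : List A) → length (rotate i xs) ≡ length xs
  length-rotate = rotate-preserves-sum length (λ xs _ → length-++ xs)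

  rotate-length : (xs : List A) → rotate (length xs) xs ≡ xs
  rotate-length xs = trans (cong (rotate (length xs)) (sym (++-identityʳ xs))) (rotate-length-++ xs [])

  length-++₃ : (X Y Z : List A) → length (X ++ Y ++ Z) ≡ length X + (length Y + length Z)
  length-++₃ X Y Z = trans (length-++ X) (cong (length X +_) (length-++ Y))

  splitAt-≤ : ∀ {u} (xs : List A) → u ≤ length xs → ∃[ X ] ∃[ Y ] xs ≡ X ++ Y × length X ≡ u
  splitAt-≤ {u} xs u≤n =
    take u xs , drop u xs , sym (take++drop≡id u xs) , trans (length-take u xs) (ℕ.m≤n⇒m⊓n≡m u≤n)

  split₃ : ∀ {u w} (xs : List A) → u ≤ w → w ≤ length xs →
           ∃[ X ] ∃[ Y ] ∃[ Z ] xs ≡ X ++ Y ++ Z × length X ≡ u × length X + length Y ≡ w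
  split₃ xs u≤w w≤n with splitAt-≤ xs w≤n
  ... | XY , Z , refl , refl with splitAt-≤ XY u≤w
  ... | X , Y , refl , refl = X , Y , Z , ++-assoc X Y Z , refl , sym (length-++ X)

  take-++-++ : (X Y Z : List A) → take (length X + length Y) (X ++ Y ++ Z) ≡ X ++ Y
  take-++-++ X Y Z rewrite sym (length-++ X {Y}) | sym (++-assoc X Y Z) = take-length-++ (X ++ Y) Z

  rotate-++-++ : (X Y Z : List A) → rotate (length X + length Y) (X ++ Y ++ Z) ≡ Z ++ X ++ Y
  rotate-++-++ X Y Z rewrite sym (length-++ X {Y}) | sym (++-assoc X Y Z) = rotate-length-++ (X ++ Y) Z

  drop-suc-length-++ : ∀ (xs : List A) y ys → drop (suc (length xs)) (xs ++ y ∷ ys) ≡ ys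
  drop-suc-length-++ []       y ys = refl
  drop-suc-length-++ (x ∷ xs) y ys = drop-suc-length-++ xs y ys

  take-suc-length-++ : ∀ (xs : List A) y ys → take (suc (length xs)) (xs ++ y ∷ ys) ≡ xs ++ y ∷ []
  take-suc-length-++ []       y ys = refl
  take-suc-length-++ (x ∷ xs) y ys = cong (x ∷_) (take-suc-length-++ xs y ys)

  step-index-< : ∀ {x : A} j (xs : List A) → take 1 (drop j xs) ≡ x ∷ [] → j < length xs
  step-index-< zero    []       ()
  step-index-< (suc j) []       ()
  step-index-< zero    (y ∷ xs) _ = s≤s z≤n
  step-index-< (suc j) (y ∷ xs) h = s≤s (step-index-< j xs h)

  last-++ : (xs : List A) (y : A) (ys : List A) → last (xs ++ y ∷ ys) ≡ last (y ∷ ys)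
  last-++ []            y ys = refl
  last-++ (x ∷ [])      y ys = refl
  last-++ (x ∷ x′ ∷ xs) y ys = last-++ (x′ ∷ xs) y ys

  module _ {R : A → A → Set} where

    linked-++⁻ˡ : ∀ xs {ys} → Linked R (xs ++ ys) → Linked R xs
    linked-++⁻ˡ []           _        = []
    linked-++⁻ˡ (x ∷ [])     _        = [-]
    linked-++⁻ˡ (x ∷ y ∷ xs) (r ∷ rs) = r ∷ linked-++⁻ˡ (y ∷ xs) rs

    linked-++⁻ʳ : ∀ xs {ys} → Linked R (xs ++ ys) → Linked R ys
    linked-++⁻ʳ []       linked = linked
    linked-++⁻ʳ (x ∷ xs) linked = linked-++⁻ʳ xs (Linked.tail linked)

    connected-from : ∀ {x} → (∀ y → R x y) → ∀ my → Connected R (just x) my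
    connected-from R-x (just y) = just (R-x y)
    connected-from R-x nothing  = just-nothing

    connected-to : ∀ {y} → (∀ x → R x y) → ∀ mx → Connected R mx (just y)
    connected-to R-y (just x) = just (R-y x)
    connected-to R-y nothing  = nothing-just

    linked-rotate : ∀ {z Q i} → (∀ y → R z y) → last Q ≡ just z → i ≤ length Q →
                    Linked R Q → Linked R (rotate i Q)
    linked-rotate {z} {Q} R-z last≡z i≤n linked with splitAt-≤ Q i≤n
    ... | X , Y , refl , refl =
      subst (Linked R) (sym (rotate-length-++ X Y))
            (Linked.++⁺ (linked-++⁻ʳ X linked) (connect Y last≡z) (linked-++⁻ˡ X linked))
      where
      connect : ∀ Y → last (X ++ Y) ≡ just z → Connected R (last Y) (head X)
      connect []       _ with head X
      ... | just _  = nothing-just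
      ... | nothing = nothing
      connect (y ∷ ys) last≡z =
        subst (λ m → Connected R m (head X)) (trans (sym last≡z) (last-++ X y ys)) (connected-from R-z (head X))

  last-rotate : ∀ {p} (Q : List A) → 0 < p → p ≤ length Q → last (rotate p Q) ≡ last (take p Q)
  last-rotate {suc p} (q ∷ Q) _ _ = last-++ (drop p Q) q (take p Q)

  last≡just⇒∷ʳ : ∀ {z} (T : List A) → last T ≡ just z → ∃[ X ] T ≡ X ++ z ∷ []
  last≡just⇒∷ʳ (y ∷ [])      refl = [] , refl
  last≡just⇒∷ʳ (y ∷ y′ ∷ T) last≡z with last≡just⇒∷ʳ (y′ ∷ T) last≡z
  ... | X , T≡ = y ∷ X , cong (y ∷_) T≡

  ending-split : ∀ {p z} (Q : List A) → p ≤ length Q → last (take p Q) ≡ just z →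
                 ∃[ X ] ∃[ Y ] Q ≡ X ++ z ∷ Y × suc (length X) ≡ p
  ending-split {z = z} Q p≤n last≡z with splitAt-≤ Q p≤n
  ... | T , D , refl , refl with last≡just⇒∷ʳ T (trans (cong last (sym (take-length-++ T D))) last≡z)
  ...   | X , refl = X , D , ++-assoc X (z ∷ []) D , sym |X++z|
    where
    |X++z| : length (X ++ z ∷ []) ≡ suc (length X)
    |X++z| = trans (length-++ X) (ℕ.+-comm (length X) 1)

data CyclicSum (n u i w : ℕ) : Set where
  direct  : u + i ≡ w     → CyclicSum n u i w
  wrapped : u + i ≡ n + w → CyclicSum n u i w

cyclicSum-exists : ∀ {n u i} → u < n → i ≤ n → ∃[ w ] w < n × CyclicSum n u i w
cyclicSum-exists {n} {u} {i} u<n i≤n with u + i <? n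
... | yes u+i<n = u + i , u+i<n , direct refl
... | no u+i≮n with ℕ.m≤n⇒∃[o]m+o≡n (ℕ.≮⇒≥ u+i≮n)
...   | w , n+w≡u+i =
  w , ℕ.+-cancelˡ-< n w n (subst (_< n + n) (sym n+w≡u+i) (ℕ.+-mono-<-≤ u<n i≤n)) , wrapped (sym n+w≡u+i)

cyclicSum-solve : ∀ {n u w} → u < n → w < n → ∃[ x ] x < n × CyclicSum n u x w
cyclicSum-solve {n} {u} {w} u<n w<n with u ≤? w
... | yes u≤w = w ∸ u , ℕ.≤-<-trans (ℕ.m∸n≤m w u) w<n , direct (ℕ.m+[n∸m]≡n u≤w)
... | no u≰w = n ∸ u + w , x<n , wrapped u+x≡n+w
  where
  u+x≡n+w : u + (n ∸ u + w) ≡ n + w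
  u+x≡n+w = trans (sym (ℕ.+-assoc u (n ∸ u) w)) (cong (_+ w) (ℕ.m+[n∸m]≡n (ℕ.<⇒≤ u<n)))
  x<n : n ∸ u + w < n
  x<n = ℕ.+-cancelˡ-< u (n ∸ u + w) n
          (subst (_< u + n) (sym u+x≡n+w) (subst (n + w <_) (ℕ.+-comm n u) (ℕ.+-monoʳ-< n (ℕ.≰⇒> u≰w))))

direct-wrapped-⊥ : ∀ {n u u′ x w} → u′ < n → u + x ≡ w → u′ + x ≡ n + w → ⊥
direct-wrapped-⊥ {n} {u} {u′} {x} u′<n e e′ = ℕ.<⇒≱ u′<n (subst (n ≤_) (sym u′≡n+u) (ℕ.m≤m+n n u))
  where
  u′≡n+u : u′ ≡ n + u
  u′≡n+u = ℕ.+-cancelʳ-≡ x u′ (n + u) (trans e′ (trans (cong (n +_) (sym e)) (sym (ℕ.+-assoc n u x))))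

cyclicSum-cancel : ∀ {n u u′ x w} → u < n → u′ < n → CyclicSum n u x w → CyclicSum n u′ x w → u ≡ u′
cyclicSum-cancel {x = x} _ _ (direct e)  (direct e′)  = ℕ.+-cancelʳ-≡ x _ _ (trans e (sym e′))
cyclicSum-cancel {x = x} _ _ (wrapped e) (wrapped e′) = ℕ.+-cancelʳ-≡ x _ _ (trans e (sym e′))
cyclicSum-cancel _ u′<n (direct e)  (wrapped e′) = ⊥-elim (direct-wrapped-⊥ u′<n e e′)
cyclicSum-cancel u<n _  (wrapped e) (direct e′)  = ⊥-elim (direct-wrapped-⊥ u<n e′ e)

module _ {A : Set} where

  -- The i-th point of rotate u P is the w-th point of P; X, Y, Z are the pieces of P cut at u and w.
  data RotationCut (P : List A) (u i w : ℕ) : Set where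
    direct  : ∀ X Y Z → P ≡ X ++ Y ++ Z →
              u ≡ length X → i ≡ length Y → w ≡ length X + length Y → RotationCut P u i w
    wrapped : ∀ X Y Z → P ≡ X ++ Y ++ Z →
              w ≡ length X → u ≡ length X + length Y → i ≡ length Z + length X → RotationCut P u i w

  rotationCut : ∀ {u i w} (P : List A) → u ≤ length P → i ≤ length P → w ≤ length P →
                CyclicSum (length P) u i w → RotationCut P u i w
  rotationCut {u} {i} P _ _ w≤n (direct u+i≡w)
    with split₃ P (subst (u ≤_) u+i≡w (ℕ.m≤m+n u i)) w≤n
  ... | X , Y , Z , P≡ , refl , |XY|≡w =
    direct X Y Z P≡ refl (ℕ.+-cancelˡ-≡ (length X) i (length Y) (trans u+i≡w (sym |XY|≡w))) (sym |XY|≡w)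
  rotationCut {u} {i} {w} P u≤n i≤n _ (wrapped u+i≡n+w)
    with split₃ P w≤u u≤n
    where
    w≤u : w ≤ u
    w≤u = ℕ.+-cancelˡ-≤ (length P) w u
            (subst (_≤ length P + u) u+i≡n+w (subst (u + i ≤_) (ℕ.+-comm u (length P)) (ℕ.+-monoʳ-≤ u i≤n)))
  ... | X , Y , Z , refl , refl , refl = wrapped X Y Z refl refl refl (ℕ.+-cancelˡ-≡ (length X + length Y) i _ i-eq)
    where
    shuffle : ∀ x y z → x + (y + z) + x ≡ x + y + (z + x)
    shuffle = solve-∀
    i-eq : length X + length Y + i ≡ length X + length Y + (length Z + length X)
    i-eq = trans u+i≡n+w (trans (cong (_+ length X) (length-++₃ X Y Z)) (shuffle (length X) (length Y) (length Z)))

  rotate-rotate : ∀ {P u i w} → RotationCut P u i w → rotate i (rotate u P) ≡ rotate w P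
  rotate-rotate (direct X Y Z refl refl refl refl) = begin
    rotate (length Y) (rotate (length X) (X ++ Y ++ Z)) ≡⟨ cong (rotate (length Y)) (rotate-length-++ X (Y ++ Z)) ⟩
    rotate (length Y) ((Y ++ Z) ++ X)                    ≡⟨ cong (rotate (length Y)) (++-assoc Y Z X) ⟩
    rotate (length Y) (Y ++ Z ++ X)                      ≡⟨ rotate-length-++ Y (Z ++ X) ⟩
    (Z ++ X) ++ Y                                        ≡⟨ ++-assoc Z X Y ⟩
    Z ++ X ++ Y                                          ≡⟨ rotate-++-++ X Y Z ⟨
    rotate (length X + length Y) (X ++ Y ++ Z)           ∎
    where open ≡-Reasoning
  rotate-rotate (wrapped X Y Z refl refl refl refl) = begin
    rotate (length Z + length X) (rotate (length X + length Y) (X ++ Y ++ Z))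
      ≡⟨ cong (rotate (length Z + length X)) (rotate-++-++ X Y Z) ⟩
    rotate (length Z + length X) (Z ++ X ++ Y) ≡⟨ rotate-++-++ Z X Y ⟩
    Y ++ Z ++ X                                ≡⟨ ++-assoc Y Z X ⟨
    (Y ++ Z) ++ X                              ≡⟨ rotate-length-++ X (Y ++ Z) ⟨
    rotate (length X) (X ++ Y ++ Z)            ∎
    where open ≡-Reasoning

  rotate-inverse : ∀ {i} (P : List A) → i ≤ length P → rotate (length P ∸ i) (rotate i P) ≡ P
  rotate-inverse {i} P i≤n =
    trans (rotate-rotate (rotationCut P i≤n (ℕ.m∸n≤m (length P) i) z≤n (wrapped i+[n∸i]≡n+0))) (rotate-zero P)
    where
    i+[n∸i]≡n+0 : i + (length P ∸ i) ≡ length P + 0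
    i+[n∸i]≡n+0 = trans (ℕ.m+[n∸m]≡n i≤n) (sym (ℕ.+-identityʳ (length P)))

  shift-sym : ∀ {Q P : List A} → IsShiftOf Q P → IsShiftOf P Q
  shift-sym {P = P} (i , i≤n , refl) =
    length P ∸ i , subst (length P ∸ i ≤_) (sym (length-rotate i P)) (ℕ.m∸n≤m (length P) i) ,
    sym (rotate-inverse P i≤n)

  shift-index : ∀ {Q P : List A} → 0 < length P → IsShiftOf Q P → ∃[ u ] u < length P × Q ≡ rotate u P
  shift-index {P = P} 0<n (i , i≤n , Q≡) with ℕ.m≤n⇒m<n∨m≡n i≤n
  ... | inj₁ i<n  = i , i<n , Q≡
  ... | inj₂ refl = 0 , 0<n , trans Q≡ (trans (rotate-length P) (sym (rotate-zero P)))

-- Levels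

#E-++ : (xs ys : List Step) → #E (xs ++ ys) ≡ #E xs + #E ys
#E-++ []       ys = refl
#E-++ (E ∷ xs) ys = cong suc (#E-++ xs ys)
#E-++ (N ∷ xs) ys = #E-++ xs ys

#N-++ : (xs ys : List Step) → #N (xs ++ ys) ≡ #N xs + #N ys
#N-++ []       ys = refl
#N-++ (E ∷ xs) ys = #N-++ xs ys
#N-++ (N ∷ xs) ys = cong suc (#N-++ xs ys)

length≡#E+#N : (xs : List Step) → length xs ≡ #E xs + #N xs
length≡#E+#N []       = refl
length≡#E+#N (E ∷ xs) = cong suc (length≡#E+#N xs)
length≡#E+#N (N ∷ xs) = trans (cong suc (length≡#E+#N xs)) (sym (ℕ.+-suc (#E xs) (#N xs)))

rotate-path : ∀ {a b} i P → IsPath a b P → IsPath a b (rotate i P)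
rotate-path i P (#E≡a , #N≡b) =
  trans (rotate-preserves-sum #E #E-++ i P) #E≡a , trans (rotate-preserves-sum #N #N-++ i P) #N≡b

path-length : ∀ {a b} P → IsPath a b P → length P ≡ a + b
path-length P (#E≡a , #N≡b) = trans (length≡#E+#N P) (cong₂ _+_ #E≡a #N≡b)

module _ (a b : ℕ) where

  -- levelAt a b Q i unfolds to endLevel (take i Q).
  endLevel : List Step → ℤ
  endLevel xs = level a b (#E xs) (#N xs)

  endLevel-++ : (xs ys : List Step) → endLevel (xs ++ ys) ≡ endLevel xs ℤ.+ endLevel ys
  endLevel-++ xs ys rewrite #E-++ xs ys | #N-++ xs ys | ℤ.pos-+ (#E xs) (#E ys) | ℤ.pos-+ (#N xs) (#N ys) =
    bilinear (ℤ.+ a) (ℤ.+ b) (ℤ.+ #E xs) (ℤ.+ #E ys) (ℤ.+ #N xs) (ℤ.+ #N ys)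
    where
    bilinear : ∀ α β x x′ y y′ → α ℤ.* (y ℤ.+ y′) ℤ.- β ℤ.* (x ℤ.+ x′) ≡
                                 (α ℤ.* y ℤ.- β ℤ.* x) ℤ.+ (α ℤ.* y′ ℤ.- β ℤ.* x′)
    bilinear = ℤ-Solver.solve-∀

  endLevel-path : ∀ P → IsPath a b P → endLevel P ≡ 0ℤ
  endLevel-path P (#E≡a , #N≡b) rewrite #E≡a | #N≡b = antisymmetric (ℤ.+ a) (ℤ.+ b)
    where
    antisymmetric : ∀ α β → α ℤ.* β ℤ.- β ℤ.* α ≡ 0ℤ
    antisymmetric = ℤ-Solver.solve-∀

  endLevel≡0⇒balanced : (Y : List Step) → endLevel Y ≡ 0ℤ → a * #N Y ≡ b * #E Y
  endLevel≡0⇒balanced Y level≡0 =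
    ℤ.+-injective (trans (ℤ.pos-* a (#N Y)) (trans (ℤ.i-j≡0⇒i≡j _ _ level≡0) (sym (ℤ.pos-* b (#E Y)))))

  levelAt-rotate : ∀ {P u i w} → endLevel P ≡ 0ℤ → RotationCut P u i w →
                   levelAt a b (rotate u P) i ≡ levelAt a b P w ℤ.- levelAt a b P u
  levelAt-rotate _ (direct X Y Z refl refl refl refl)
    rewrite rotate-length-++ X (Y ++ Z) | ++-assoc Y Z X | take-length-++ Y (Z ++ X)
          | take-++-++ X Y Z | take-length-++ X (Y ++ Z) | endLevel-++ X Y
    = difference (endLevel X) (endLevel Y)
    where
    difference : ∀ x y → y ≡ x ℤ.+ y ℤ.- x
    difference = ℤ-Solver.solve-∀
  levelAt-rotate P-closed (wrapped X Y Z refl refl refl refl)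
    rewrite rotate-++-++ X Y Z | take-++-++ Z X Y | take-length-++ X (Y ++ Z)
          | take-++-++ X Y Z | endLevel-++ Z X | endLevel-++ X Y
    = closing (endLevel X) (endLevel Y) (endLevel Z) P-closed′
    where
    P-closed′ : endLevel X ℤ.+ (endLevel Y ℤ.+ endLevel Z) ≡ 0ℤ
    P-closed′ = trans (sym (trans (endLevel-++ X (Y ++ Z)) (cong (ℤ._+_ (endLevel X)) (endLevel-++ Y Z)))) P-closed
    shift : ∀ x y z → z ℤ.+ x ≡ (x ℤ.+ (y ℤ.+ z)) ℤ.+ (x ℤ.- (x ℤ.+ y))
    shift = ℤ-Solver.solve-∀
    closing : ∀ x y z → x ℤ.+ (y ℤ.+ z) ≡ 0ℤ → z ℤ.+ x ≡ x ℤ.- (x ℤ.+ y)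
    closing x y z h = trans (shift x y z) (trans (cong (ℤ._+ (x ℤ.- (x ℤ.+ y))) h) (ℤ.+-identityˡ _))

0<i-j⇒j<i : ∀ {i j} → 0ℤ ℤ.< i ℤ.- j → j ℤ.< i
0<i-j⇒j<i 0<i-j = ℤ.≰⇒> (λ i≤j → ℤ.<⇒≱ 0<i-j (ℤ.i≤j⇒i-j≤0 i≤j))

j<i⇒0<i-j : ∀ {i j} → j ℤ.< i → 0ℤ ℤ.< i ℤ.- j
j<i⇒0<i-j j<i = ℤ.≰⇒> (λ i-j≤0 → ℤ.<⇒≱ j<i (ℤ.i-j≤0⇒i≤j i-j≤0))

coprime-small-solution : ∀ {a b e m} → Coprime a b → a * m ≡ b * e → e < a → e ≡ 0 × m ≡ 0
coprime-small-solution {a} {b} {e} {m} cop am≡be e<a with coprime-divisor cop (divides m (trans (sym am≡be) (ℕ.*-comm a m)))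
... | a∣e with e
...   | suc _ = contradiction a∣e (>⇒∤ e<a)
...   | zero with ℕ.m*n≡0⇒m≡0∨n≡0 a (trans am≡be (ℕ.*-zeroʳ b))
...     | inj₂ m≡0 = refl , m≡0
...     | inj₁ refl with () ← e<a

module _ {a b : ℕ} (0<a : 0 < a) (cop : Coprime a b) where

  level-zero-segment : (Y : List Step) → endLevel a b Y ≡ 0ℤ → #E Y ≤ a → length Y ≡ 0 ⊎ length Y ≡ a + b
  level-zero-segment Y level≡0 #E≤a with ℕ.m≤n⇒m<n∨m≡n #E≤a
  ... | inj₁ #E<a with coprime-small-solution cop (endLevel≡0⇒balanced a b Y level≡0) #E<a
  ...   | #E≡0 , #N≡0 = inj₁ (trans (length≡#E+#N Y) (cong₂ _+_ #E≡0 #N≡0))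
  level-zero-segment Y level≡0 #E≤a | inj₂ #E≡a = inj₂ (trans (length≡#E+#N Y) (cong₂ _+_ #E≡a #N≡b))
    where
    #N≡b : #N Y ≡ b
    #N≡b = ℕ.*-cancelˡ-≡ (#N Y) b a {{>-nonZero 0<a}}
             (trans (endLevel≡0⇒balanced a b Y level≡0) (trans (cong (b *_) #E≡a) (ℕ.*-comm b a)))

  levels-distinct : ∀ {P i j} → IsPath a b P → i < j → j < length P → levelAt a b P i ≢ levelAt a b P j
  levels-distinct {P} path@(#E≡a , _) i<j j<n same with split₃ P (ℕ.<⇒≤ i<j) (ℕ.<⇒≤ j<n)
  ... | X , Y , Z , refl , refl , refl with level-zero-segment Y Y-level #E-Y≤a
    where
    Y-level : endLevel a b Y ≡ 0ℤ
    Y-level = identityʳ-unique (endLevel a b X) (endLevel a b Y) (sym (begin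
      endLevel a b X                            ≡⟨ cong (endLevel a b) (take-length-++ X (Y ++ Z)) ⟨
      levelAt a b (X ++ Y ++ Z) (length X)      ≡⟨ same ⟩
      levelAt a b (X ++ Y ++ Z) (length X + length Y) ≡⟨ cong (endLevel a b) (take-++-++ X Y Z) ⟩
      endLevel a b (X ++ Y)                     ≡⟨ endLevel-++ a b X Y ⟩
      endLevel a b X ℤ.+ endLevel a b Y         ∎))
      where open ≡-Reasoning
    #E-Y≤a : #E Y ≤ a
    #E-Y≤a = begin
      #E Y                        ≤⟨ ℕ.m≤n+m (#E Y) (#E X) ⟩
      #E X + #E Y                 ≤⟨ ℕ.m≤m+n (#E X + #E Y) (#E Z) ⟩
      #E X + #E Y + #E Z          ≡⟨ ℕ.+-assoc (#E X) (#E Y) (#E Z) ⟩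
      #E X + (#E Y + #E Z)        ≡⟨ cong (#E X +_) (#E-++ Y Z) ⟨
      #E X + #E (Y ++ Z)          ≡⟨ #E-++ X (Y ++ Z) ⟨
      #E (X ++ Y ++ Z)            ≡⟨ #E≡a ⟩
      a                           ∎
      where open ℕ.≤-Reasoning
  ...   | inj₁ |Y|≡0 = ℕ.<-irrefl (sym (ℕ.+-identityʳ (length X))) (subst (λ y → length X < length X + y) |Y|≡0 i<j)
  ...   | inj₂ |Y|≡a+b = ℕ.<⇒≱ j<n (begin
      length (X ++ Y ++ Z) ≡⟨ path-length (X ++ Y ++ Z) path ⟩
      a + b                ≡⟨ |Y|≡a+b ⟨
      length Y             ≤⟨ ℕ.m≤n+m (length Y) (length X) ⟩
      length X + length Y  ∎)
      where open ℕ.≤-Reasoning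

  levelAt-injective : ∀ {P i j} → IsPath a b P → i < length P → j < length P →
                      levelAt a b P i ≡ levelAt a b P j → i ≡ j
  levelAt-injective {i = i} {j} path i<n j<n same with ℕ.<-cmp i j
  ... | tri< i<j _ _ = contradiction same (levels-distinct path i<j j<n)
  ... | tri≈ _ i≡j _ = i≡j
  ... | tri> _ _ j<i = contradiction (sym same) (levels-distinct path j<i i<n)

-- Skeletal shifts

_≟-step_ : (s t : Step) → Dec (s ≡ t)
E ≟-step E = yes refl
E ≟-step N = no λ ()
N ≟-step E = no λ ()
N ≟-step N = yes refl

module _ (a b k : ℕ) where

  R1? : (Q : List Step) → Dec (R1 a b k Q)
  R1? Q = map′ (λ r1 j is-north few-after → r1 (step-index-< j Q is-north) is-north few-after) (λ r1 {j} _ → r1 j)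
                (ℕ.allUpTo? (λ j → ≡-dec _≟-step_ (take 1 (drop j Q)) (N ∷ [])
                                   →-dec (#N (drop (suc j) Q) ℕ.≤? k)
                                   →-dec (0ℤ ℤ.≤? levelAt a b Q j))
                            (length Q))

  R2? : (Q : List Step) → Dec (R2 a b k Q)
  R2? Q = map′ (λ r2 i i≤n → r2 (s≤s i≤n)) (λ r2 {i} i<1+n → r2 i (ℕ.≤-pred i<1+n))
                (ℕ.allUpTo? (λ i → (0ℤ ℤ.<? levelAt a b Q i) →-dec ¬? (R1? (rotate i Q))) (suc (length Q)))

  skeletal? : (Q : List Step) → Dec (Skeletal a b k Q)
  skeletal? Q = R1? Q ×-dec R2? Q

module Skeleton {a b : ℕ} (k : ℕ) (0<a : 0 < a) (cop : Coprime a b) (P : List Step) (path : IsPath a b P) where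

  private
    n : ℕ
    n = length P
    L : ℕ → ℤ
    L = levelAt a b P
    closed : endLevel a b P ≡ 0ℤ
    closed = endLevel-path a b P path

  0<n : 0 < n
  0<n = subst (0 <_) (sym (path-length P path)) (ℕ.<-≤-trans 0<a (ℕ.m≤m+n a b))

  record SamePoint (u i w : ℕ) : Set where
    field
      sum     : CyclicSum n u i w
      rotates : rotate i (rotate u P) ≡ rotate w P
      relative-level : levelAt a b (rotate u P) i ≡ L w ℤ.- L u

  samePoint : ∀ {u i w} → u < n → i ≤ n → w < n → CyclicSum n u i w → SamePoint u i w
  samePoint u<n i≤n w<n sum = record
    { sum = sum ; rotates = rotate-rotate c ; relative-level = levelAt-rotate a b closed c }
    where c = rotationCut P (ℕ.<⇒≤ u<n) i≤n (ℕ.<⇒≤ w<n) sum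

  samePoint-forward : ∀ {u i} → u < n → i ≤ n → ∃[ w ] w < n × SamePoint u i w
  samePoint-forward u<n i≤n with cyclicSum-exists u<n i≤n
  ... | w , w<n , sum = w , w<n , samePoint u<n i≤n w<n sum

  samePoint-backward : ∀ {u w} → u < n → w < n → ∃[ i ] i < n × SamePoint u i w
  samePoint-backward u<n w<n with cyclicSum-solve u<n w<n
  ... | i , i<n , sum = i , i<n , samePoint u<n (ℕ.<⇒≤ i<n) w<n sum

  open SamePoint

  R1-rotate-lowest : ∀ {m} → m < n → (∀ {w} → w < n → L m ℤ.≤ L w) → R1 a b k (rotate m P)
  R1-rotate-lowest {m} m<n m-lowest j is-north _
    with samePoint-forward m<n (ℕ.<⇒≤ (subst (j <_) (length-rotate m P) (step-index-< j _ is-north)))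
  ... | w , w<n , same = subst (0ℤ ℤ.≤_) (sym (relative-level same)) (ℤ.i≤j⇒0≤j-i (m-lowest w<n))

  R2-rotate-highest : ∀ {v} → v < n → (∀ {w} → w < n → R1 a b k (rotate w P) → L w ℤ.≤ L v) →
                      R2 a b k (rotate v P)
  R2-rotate-highest {v} v<n v-highest i i≤len positive r1 with samePoint-forward v<n (subst (i ≤_) (length-rotate v P) i≤len)
  ... | w , w<n , same = ℤ.<⇒≱ (0<i-j⇒j<i (subst (0ℤ ℤ.<_) (relative-level same) positive))
                                (v-highest w<n (subst (R1 a b k) (rotates same) r1))

  skeletal-highest : ∀ {u w} → u < n → Skeletal a b k (rotate u P) → w < n → R1 a b k (rotate w P) → L w ℤ.≤ L u
  skeletal-highest {u} {w} u<n (_ , r2) w<n r1 with L w ℤ.≤? L u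
  ... | yes w≤u = w≤u
  ... | no w≰u with samePoint-backward u<n w<n
  ...   | i , i<n , same = ⊥-elim (r2 i (ℕ.<⇒≤ (subst (i <_) (sym (length-rotate u P)) i<n))
                                     (subst (0ℤ ℤ.<_) (sym (relative-level same)) (j<i⇒0<i-j (ℤ.≰⇒> w≰u)))
                                     (subst (R1 a b k) (sym (rotates same)) r1))

  skeletal-index-unique : ∀ {u w} → u < n → w < n → Skeletal a b k (rotate u P) → Skeletal a b k (rotate w P) → u ≡ w
  skeletal-index-unique u<n w<n skel-u skel-w = levelAt-injective 0<a cop path u<n w<n
    (ℤ.≤-antisym (skeletal-highest w<n skel-w u<n (proj₁ skel-u)) (skeletal-highest u<n skel-u w<n (proj₁ skel-w)))

  private
    lowest : ℕ
    lowest = ℤ-Extrema.argmin L 0 (upTo n)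

    lowest<n : lowest < n
    lowest<n = ℤ-Extrema.argmin-all L 0<n (all-upTo n)

    lowest-min : ∀ {w} → w < n → L lowest ℤ.≤ L w
    lowest-min w<n = All.lookup (ℤ-Extrema.f[argmin]≤f[xs] 0 (upTo n)) (∈-upTo⁺ w<n)

    R1-rotations : List ℕ
    R1-rotations = filter (λ v → R1? a b k (rotate v P)) (upTo n)

    highest : ℕ
    highest = ℤ-Extrema.argmax L lowest R1-rotations

    highest<n×R1 : highest < n × R1 a b k (rotate highest P)
    highest<n×R1 = ℤ-Extrema.argmax-all L (lowest<n , R1-rotate-lowest lowest<n lowest-min) (All.tabulate members)
      where
      members : ∀ {v} → v ∈ R1-rotations → v < n × R1 a b k (rotate v P)
      members v∈ with ∈-filter⁻ (λ v → R1? a b k (rotate v P)) v∈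
      ... | v∈upTo , r1 = ∈-upTo⁻ v∈upTo , r1

    highest-max : ∀ {w} → w < n → R1 a b k (rotate w P) → L w ℤ.≤ L highest
    highest-max w<n r1 =
      All.lookup (ℤ-Extrema.f[xs]≤f[argmax] lowest R1-rotations)
                 (∈-filter⁺ (λ v → R1? a b k (rotate v P)) (∈-upTo⁺ w<n) r1)

  skeletal-rotation : ∃[ v ] v < n × Skeletal a b k (rotate v P)
  skeletal-rotation =
    highest , proj₁ highest<n×R1 , proj₂ highest<n×R1 , R2-rotate-highest (proj₁ highest<n×R1) highest-max

  rotate-injective : ∀ {i j} → i < n → j < n → rotate i P ≡ rotate j P → i ≡ j
  rotate-injective {i} {j} i<n j<n same-rotation =
    let v , v<n , skel-v   = skeletal-rotation
        x , x<n , from-i   = samePoint-backward i<n v<n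
        w , w<n , from-j   = samePoint-forward j<n (ℕ.<⇒≤ x<n)
        rotate-w≡rotate-v  = trans (sym (rotates from-j)) (trans (cong (rotate x) (sym same-rotation)) (rotates from-i))
        w≡v                = skeletal-index-unique w<n v<n (subst (Skeletal a b k) (sym rotate-w≡rotate-v) skel-v) skel-v
    in cyclicSum-cancel i<n j<n (sum from-i) (subst (CyclicSum n j x) w≡v (sum from-j))

  rotate-n≡rotate-0 : rotate n P ≡ rotate 0 P
  rotate-n≡rotate-0 = trans (rotate-length P) (sym (rotate-zero P))

  rotate-injective⁺ : ∀ {i j} → 0 < i → 0 < j → i ≤ n → j ≤ n → rotate i P ≡ rotate j P → i ≡ j
  rotate-injective⁺ {i} {j} 0<i 0<j i≤n j≤n same with ℕ.m≤n⇒m<n∨m≡n i≤n | ℕ.m≤n⇒m<n∨m≡n j≤n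
  ... | inj₁ i<n  | inj₁ j<n  = rotate-injective i<n j<n same
  ... | inj₂ refl | inj₂ refl = refl
  ... | inj₁ i<n  | inj₂ refl = contradiction (rotate-injective i<n 0<n (trans same rotate-n≡rotate-0)) (ℕ.>⇒≢ 0<i)
  ... | inj₂ refl | inj₁ j<n  = contradiction (rotate-injective j<n 0<n (trans (sym same) rotate-n≡rotate-0)) (ℕ.>⇒≢ 0<j)

  skeletal-shift-unique : ∀ {Q Q′} → Skeletal a b k Q → IsShiftOf Q P →
                          Skeletal a b k Q′ → IsShiftOf Q′ P → Q ≡ Q′
  skeletal-shift-unique skel shift skel′ shift′ =
    let u  , u<n  , Q≡  = shift-index 0<n shift
        u′ , u′<n , Q′≡ = shift-index 0<n shift′
        u≡u′ = skeletal-index-unique u<n u′<n (subst (Skeletal a b k) Q≡ skel) (subst (Skeletal a b k) Q′≡ skel′)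
    in trans Q≡ (trans (cong (λ i → rotate i P) u≡u′) (sym Q′≡))

  unique-skeletal-shift : ∃! (λ Q → Skeletal a b k Q × IsShiftOf Q P)
  unique-skeletal-shift =
    let v , v<n , skel = skeletal-rotation
        shift = v , ℕ.<⇒≤ v<n , refl
    in rotate v P , (skel , shift) , λ Q (skel-Q , shift-Q) → skeletal-shift-unique skel-Q shift-Q skel shift

-- The final north step of R ++ N ∷ [] starts at level -a < 0.
R1-fails-at-final-north : ∀ {a b k} R → 0 < a → IsPath a b (R ++ N ∷ []) → ¬ R1 a b k (R ++ N ∷ [])
R1-fails-at-final-north {a} {b} R 0<a path r1 = ℕ.<⇒≱ 0<a (ℤ.drop‿+≤+ a≤0)
  where
  R-nonneg : 0ℤ ℤ.≤ endLevel a b R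
  R-nonneg = subst (λ Q → 0ℤ ℤ.≤ endLevel a b Q) (take-length-++ R (N ∷ []))
               (r1 (length R) (cong (take 1) (drop-length-++ R (N ∷ [])))
                   (subst (λ Q → #N Q ≤ _) (sym (drop-suc-length-++ R N [])) z≤n))
  north-level : ∀ α β → α ℤ.* ℤ.+ 1 ℤ.- β ℤ.* 0ℤ ≡ α
  north-level = ℤ-Solver.solve-∀
  R+a≡0 : endLevel a b R ℤ.+ ℤ.+ a ≡ 0ℤ
  R+a≡0 = trans (cong (ℤ._+_ (endLevel a b R)) (sym (north-level (ℤ.+ a) (ℤ.+ b))))
                (trans (sym (endLevel-++ a b R (N ∷ []))) (endLevel-path a b (R ++ N ∷ []) path))
  a≤0 : ℤ.+ a ℤ.≤ 0ℤ
  a≤0 = subst (ℤ.+ a ℤ.≤_) R+a≡0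
          (subst (ℤ._≤ endLevel a b R ℤ.+ ℤ.+ a) (ℤ.+-identityˡ (ℤ.+ a)) (ℤ.+-monoˡ-≤ (ℤ.+ a) R-nonneg))

R1⇒ends-east : ∀ {a b k} P → 0 < a → IsPath a b P → R1 a b k P → last P ≡ just E
R1⇒ends-east P 0<a path r1 with initLast P
... | []      = contradiction (sym (proj₁ path)) (ℕ.>⇒≢ 0<a)
... | R ∷ʳ′ E = last-++ R E []
... | R ∷ʳ′ N = contradiction r1 (R1-fails-at-final-north R 0<a path)

-- Counting lattice paths

module _ {A B : Set} where

  Unique-map-injectiveOn : (f : B → A) {xs : List B} → Unique xs →
                           (∀ {x y} → x ∈ xs → y ∈ xs → f x ≡ f y → x ≡ y) → Unique (map f xs)
  Unique-map-injectiveOn f []           _   = []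
  Unique-map-injectiveOn f (x∉ ∷ uniq) inj =
    All-map⁺ (All.tabulate (λ y∈ fx≡fy → All.lookup x∉ y∈ (inj (here refl) (there y∈) fx≡fy)))
    ∷ Unique-map-injectiveOn f uniq (λ x∈ y∈ → inj (there x∈) (there y∈))

  length-cartesianProduct : (xs : List A) (ys : List B) → length (cartesianProduct xs ys) ≡ length xs * length ys
  length-cartesianProduct []       ys = refl
  length-cartesianProduct (x ∷ xs) ys =
    trans (length-++ (map (x ,_) ys)) (cong₂ _+_ (length-map (x ,_) ys) (length-cartesianProduct xs ys))

module _ {A B : Set} where

  length-orbits : ∀ {X : List A} {S : List B} {m} (r : B → ℕ → A) → Unique X → Unique S →
                  (∀ {x} → x ∈ X → ∃[ s ] ∃[ i ] s ∈ S × i < m × x ≡ r s i) →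
                  (∀ {s i} → s ∈ S → i < m → r s i ∈ X) →
                  (∀ {s s′ i i′} → s ∈ S → s′ ∈ S → i < m → i′ < m → r s i ≡ r s′ i′ → s ≡ s′ × i ≡ i′) →
                  length X ≡ length S * m
  length-orbits {X} {S} {m} r unique-X unique-S cover into injective = begin
    length X       ≡⟨ ↭.↭-length (∼bag⇒↭ (unique∧set⇒bag unique-X unique-orbits (mk⇔ to from))) ⟩
    length orbits  ≡⟨ length-map (uncurry r) (cartesianProduct S (upTo m)) ⟩
    length (cartesianProduct S (upTo m)) ≡⟨ length-cartesianProduct S (upTo m) ⟩
    length S * length (upTo m)           ≡⟨ cong (length S *_) (length-upTo m) ⟩
    length S * m                         ∎
    where
    open ≡-Reasoning
    orbits : List A
    orbits = map (uncurry r) (cartesianProduct S (upTo m))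
    unique-orbits : Unique orbits
    unique-orbits = Unique-map-injectiveOn (uncurry r) (Unique.cartesianProduct⁺ unique-S (Unique.upTo⁺ m)) inj
      where
      inj : ∀ {p q} → p ∈ cartesianProduct S (upTo m) → q ∈ cartesianProduct S (upTo m) →
            uncurry r p ≡ uncurry r q → p ≡ q
      inj p∈ q∈ same with ∈-cartesianProduct⁻ S (upTo m) p∈ | ∈-cartesianProduct⁻ S (upTo m) q∈
      ... | s∈ , i∈ | s′∈ , i′∈ = ×-≡,≡→≡ (injective s∈ s′∈ (∈-upTo⁻ i∈) (∈-upTo⁻ i′∈) same)
    to : ∀ {x} → x ∈ X → x ∈ orbits
    to x∈ with cover x∈
    ... | s , i , s∈ , i<m , refl = ∈-map⁺ (uncurry r) (∈-cartesianProduct⁺ s∈ (∈-upTo⁺ i<m))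
    from : ∀ {x} → x ∈ orbits → x ∈ X
    from x∈ with ∈-map⁻ (uncurry r) x∈
    ... | (s , i) , p∈ , refl with ∈-cartesianProduct⁻ S (upTo m) p∈
    ...   | s∈ , i∈ = into s∈ (∈-upTo⁻ i∈)

paths : ℕ → ℕ → List (List Step)
paths zero    zero    = [] ∷ []
paths zero    (suc b) = map (N ∷_) (paths zero b)
paths (suc a) zero    = map (E ∷_) (paths a zero)
paths (suc a) (suc b) = map (E ∷_) (paths a (suc b)) ++ map (N ∷_) (paths (suc a) b)

∈-paths : ∀ xs → xs ∈ paths (#E xs) (#N xs)
∈-paths []       = here refl
∈-paths (E ∷ xs) with #N xs | ∈-paths xs
... | zero  | xs∈ = ∈-map⁺ (E ∷_) xs∈
... | suc _ | xs∈ = ∈-++⁺ˡ (∈-map⁺ (E ∷_) xs∈)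
∈-paths (N ∷ xs) with #E xs | ∈-paths xs
... | zero  | xs∈ = ∈-map⁺ (N ∷_) xs∈
... | suc a | xs∈ = ∈-++⁺ʳ (map (E ∷_) (paths a _)) (∈-map⁺ (N ∷_) xs∈)

∈-paths⁺ : ∀ {a b xs} → IsPath a b xs → xs ∈ paths a b
∈-paths⁺ {xs = xs} (refl , refl) = ∈-paths xs

∈-paths⁻ : ∀ a b {xs} → xs ∈ paths a b → IsPath a b xs
∈-paths⁻ zero    zero    (here refl) = refl , refl
∈-paths⁻ zero    (suc b) xs∈ with ∈-map⁻ (N ∷_) xs∈
... | _ , ys∈ , refl = Product.map₂ (cong suc) (∈-paths⁻ zero b ys∈)
∈-paths⁻ (suc a) zero    xs∈ with ∈-map⁻ (E ∷_) xs∈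
... | _ , ys∈ , refl = Product.map₁ (cong suc) (∈-paths⁻ a zero ys∈)
∈-paths⁻ (suc a) (suc b) xs∈ with ∈-++⁻ (map (E ∷_) (paths a (suc b))) xs∈
... | inj₁ xs∈E with ∈-map⁻ (E ∷_) xs∈E
...   | _ , ys∈ , refl = Product.map₁ (cong suc) (∈-paths⁻ a (suc b) ys∈)
∈-paths⁻ (suc a) (suc b) xs∈ | inj₂ xs∈N with ∈-map⁻ (N ∷_) xs∈N
...   | _ , ys∈ , refl = Product.map₂ (cong suc) (∈-paths⁻ (suc a) b ys∈)

paths-unique : ∀ a b → Unique (paths a b)
paths-unique zero    zero    = All.[] ∷ []
paths-unique zero    (suc b) = Unique.map⁺ ∷-injectiveʳ (paths-unique zero b)
paths-unique (suc a) zero    = Unique.map⁺ ∷-injectiveʳ (paths-unique a zero)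
paths-unique (suc a) (suc b) =
  Unique.++⁺ (Unique.map⁺ ∷-injectiveʳ (paths-unique a (suc b))) (Unique.map⁺ ∷-injectiveʳ (paths-unique (suc a) b))
             east≢north
  where
  east≢north : ∀ {xs} → ¬ (xs ∈ map (E ∷_) (paths a (suc b)) × xs ∈ map (N ∷_) (paths (suc a) b))
  east≢north (xs∈E , xs∈N) with ∈-map⁻ (E ∷_) xs∈E | ∈-map⁻ (N ∷_) xs∈N
  ... | _ , _ , refl | _ , _ , ()

length-paths : ∀ a b → length (paths a b) ≡ (a + b) C a
length-paths zero    zero    = refl
length-paths zero    (suc b) = trans (length-map (N ∷_) (paths zero b)) (length-paths zero b)
length-paths (suc a) zero    = begin
  length (map (E ∷_) (paths a zero)) ≡⟨ length-map (E ∷_) (paths a zero) ⟩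
  length (paths a zero)              ≡⟨ length-paths a zero ⟩
  (a + 0) C a                        ≡⟨ cong (_C a) (ℕ.+-identityʳ a) ⟩
  a C a                              ≡⟨ nCn≡1 a ⟩
  1                                  ≡⟨ nCn≡1 (suc a) ⟨
  suc a C suc a                      ≡⟨ cong (_C suc a) (ℕ.+-identityʳ (suc a)) ⟨
  (suc a + 0) C suc a                ∎
  where open ≡-Reasoning
length-paths (suc a) (suc b) = begin
  length (map (E ∷_) (paths a (suc b)) ++ map (N ∷_) (paths (suc a) b))
    ≡⟨ length-++ (map (E ∷_) (paths a (suc b))) ⟩
  length (map (E ∷_) (paths a (suc b))) + length (map (N ∷_) (paths (suc a) b))
    ≡⟨ cong₂ _+_ (length-map (E ∷_) (paths a (suc b))) (length-map (N ∷_) (paths (suc a) b)) ⟩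
  length (paths a (suc b)) + length (paths (suc a) b)
    ≡⟨ cong₂ _+_ (length-paths a (suc b)) (length-paths (suc a) b) ⟩
  (a + suc b) C a + (suc a + b) C suc a
    ≡⟨ cong (λ m → (a + suc b) C a + m C suc a) (ℕ.+-suc a b) ⟨
  (a + suc b) C a + (a + suc b) C suc a
    ≡⟨ nCk+nC[k+1]≡[n+1]C[k+1] (a + suc b) a ⟩
  suc (a + suc b) C suc a ∎
  where open ≡-Reasoning

module _ {a b : ℕ} (k : ℕ) (0<a : 0 < a) (cop : Coprime a b) where

  skeletalPaths : List (List Step)
  skeletalPaths = filter (skeletal? a b k) (paths a b)

  ∈-skeletalPaths : ∀ Q → (Q ∈ skeletalPaths) ⇔ (IsPath a b Q × Skeletal a b k Q)
  ∈-skeletalPaths Q = mk⇔ (Product.map₁ (∈-paths⁻ a b) ∘ ∈-filter⁻ (skeletal? a b k))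
                          (uncurry (∈-filter⁺ (skeletal? a b k) ∘ ∈-paths⁺))

  skeletalPaths-unique : Unique skeletalPaths
  skeletalPaths-unique = Unique.filter⁺ (skeletal? a b k) (paths-unique a b)

  skeletalPaths-count : HasCount (λ Q → IsPath a b Q × Skeletal a b k Q) (length skeletalPaths)
  skeletalPaths-count = skeletalPaths , skeletalPaths-unique , ∈-skeletalPaths , refl

  paths≡skeletalPaths*[a+b] : length (paths a b) ≡ length skeletalPaths * (a + b)
  paths≡skeletalPaths*[a+b] =
    length-orbits (λ s i → rotate i s) (paths-unique a b) skeletalPaths-unique cover into injective
    where
    open Equivalence
    cover : ∀ {x} → x ∈ paths a b → ∃[ s ] ∃[ i ] s ∈ skeletalPaths × i < a + b × x ≡ rotate i s
    cover {x} x∈ =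
      let path = ∈-paths⁻ a b x∈
          v , v<n , skel = Skeleton.skeletal-rotation k 0<a cop x path
          s-path = rotate-path v x path
          0<|s| = Skeleton.0<n k 0<a cop (rotate v x) s-path
          i , i<|s| , x≡ = shift-index 0<|s| (shift-sym (v , ℕ.<⇒≤ v<n , refl))
      in rotate v x , i , from (∈-skeletalPaths _) (s-path , skel) ,
         subst (i <_) (path-length (rotate v x) s-path) i<|s| , x≡
    into : ∀ {s i} → s ∈ skeletalPaths → i < a + b → rotate i s ∈ paths a b
    into {s} {i} s∈ _ = ∈-paths⁺ (rotate-path i s (proj₁ (to (∈-skeletalPaths s) s∈)))
    injective : ∀ {s s′ i i′} → s ∈ skeletalPaths → s′ ∈ skeletalPaths → i < a + b → i′ < a + b →
                rotate i s ≡ rotate i′ s′ → s ≡ s′ × i ≡ i′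
    injective {s} {s′} {i} {i′} s∈ s′∈ i<a+b i′<a+b same =
      let s-path , s-skel   = to (∈-skeletalPaths s) s∈
          s′-path , s′-skel = to (∈-skeletalPaths s′) s′∈
          i<|s|    = subst (i <_) (sym (path-length s s-path)) i<a+b
          i′<|s|   = subst (i′ <_) (sym (path-length s s-path)) i′<a+b
          i′<|s′|  = subst (i′ <_) (sym (path-length s′ s′-path)) i′<a+b
          s-shift  = shift-sym (i , ℕ.<⇒≤ i<|s| , refl)
          s′-shift = subst (IsShiftOf s′) (sym same) (shift-sym (i′ , ℕ.<⇒≤ i′<|s′| , refl))
          s≡s′     = Skeleton.skeletal-shift-unique k 0<a cop (rotate i s) (rotate-path i s s-path)
                       s-skel s-shift s′-skel s′-shift
      in s≡s′ , Skeleton.rotate-injective k 0<a cop s s-path i<|s| i′<|s| (trans same (cong (rotate i′) (sym s≡s′)))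

-- Labeled paths

forget : LStep → Step
forget east      = E
forget (north _) = N

underlying≡map : ∀ Q → underlying Q ≡ map forget Q
underlying≡map []            = refl
underlying≡map (east ∷ Q)    = cong (E ∷_) (underlying≡map Q)
underlying≡map (north _ ∷ Q) = cong (N ∷_) (underlying≡map Q)

underlying-++ : ∀ Q R → underlying (Q ++ R) ≡ underlying Q ++ underlying R
underlying-++ []            R = refl
underlying-++ (east ∷ Q)    R = cong (E ∷_) (underlying-++ Q R)
underlying-++ (north _ ∷ Q) R = cong (N ∷_) (underlying-++ Q R)

length-underlying : ∀ Q → length (underlying Q) ≡ length Q
length-underlying Q = trans (cong length (underlying≡map Q)) (length-map forget Q)

underlying-rotate : ∀ i Q → underlying (rotate i Q) ≡ rotate i (underlying Q)
underlying-rotate i Q rewrite underlying≡map (rotate i Q) | underlying≡map Q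
                            | map-++ forget (drop i Q) (take i Q) | drop-map {f = forget} i Q | take-map {f = forget} i Q = refl

#east #north : List LStep → ℕ
#east Q  = #E (underlying Q)
#north Q = #N (underlying Q)

#east-++ : ∀ Q R → #east (Q ++ R) ≡ #east Q + #east R
#east-++ Q R = trans (cong #E (underlying-++ Q R)) (#E-++ (underlying Q) (underlying R))

#north-++ : ∀ Q R → #north (Q ++ R) ≡ #north Q + #north R
#north-++ Q R = trans (cong #N (underlying-++ Q R)) (#N-++ (underlying Q) (underlying R))

labels-++ : ∀ Q R → labels (Q ++ R) ≡ labels Q ++ labels R
labels-++ []            R = refl
labels-++ (east ∷ Q)    R = labels-++ Q R
labels-++ (north l ∷ Q) R = cong (l ∷_) (labels-++ Q R)

labels-rotate : ∀ i Q → labels (rotate i Q) ↭ labels Q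
labels-rotate i Q = begin
  labels (drop i Q ++ take i Q)          ≡⟨ labels-++ (drop i Q) (take i Q) ⟩
  labels (drop i Q) ++ labels (take i Q) ↭⟨ ↭.++-comm (labels (drop i Q)) (labels (take i Q)) ⟩
  labels (take i Q) ++ labels (drop i Q) ≡⟨ labels-++ (take i Q) (drop i Q) ⟨
  labels (take i Q ++ drop i Q)          ≡⟨ cong labels (take++drop≡id i Q) ⟩
  labels Q                               ∎
  where open PermutationReasoning

NorthAscending : LStep → LStep → Set
NorthAscending (north l) (north l′) = l < l′
NorthAscending east      _          = ⊤
NorthAscending (north _) east       = ⊤

ascending-before-east : ∀ x → NorthAscending x east
ascending-before-east east      = tt
ascending-before-east (north _) = tt

ascending⇒linked : ∀ Q → (∀ i l l′ → take 2 (drop i Q) ≡ north l ∷ north l′ ∷ [] → l < l′) →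
                   Linked NorthAscending Q
ascending⇒linked []          _         = []
ascending⇒linked (x ∷ [])    _         = [-]
ascending⇒linked (x ∷ y ∷ Q) ascending = first-pair x y (ascending 0) ∷ ascending⇒linked (y ∷ Q) (ascending ∘ suc)
  where
  first-pair : ∀ x y → (∀ l l′ → x ∷ y ∷ [] ≡ north l ∷ north l′ ∷ [] → l < l′) → NorthAscending x y
  first-pair (north l) (north l′) h = h l l′ refl
  first-pair east      _          _ = tt
  first-pair (north _) east       _ = tt

linked⇒ascending : ∀ {Q} → Linked NorthAscending Q →
                   ∀ i l l′ → take 2 (drop i Q) ≡ north l ∷ north l′ ∷ [] → l < l′
linked⇒ascending []       zero    _ _ ()
linked⇒ascending []       (suc i) _ _ ()
linked⇒ascending [-]      zero    _ _ ()
linked⇒ascending [-]      (suc i) = linked⇒ascending [] i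
linked⇒ascending (r ∷ _)  zero    _ _ refl = r
linked⇒ascending (_ ∷ rs) (suc i) = linked⇒ascending rs i

rotate-labeled : ∀ {a b Q i} → last Q ≡ just east → i ≤ length Q →
                 IsLabeledPath a b Q → IsLabeledPath a b (rotate i Q)
rotate-labeled {a} {b} {Q} {i} last≡east i≤n (path , perm , ascending) =
  subst (IsPath a b) (sym (underlying-rotate i Q)) (rotate-path i (underlying Q) path) ,
  ↭-trans (labels-rotate i Q) perm ,
  linked⇒ascending (linked-rotate (λ _ → tt) last≡east i≤n (ascending⇒linked Q ascending))

R1⇒labeled-ends-east : ∀ {a b k} S → 0 < a → IsLabeledPath a b S → R1 a b k (underlying S) → last S ≡ just east
R1⇒labeled-ends-east S 0<a (path , _) r1 =
  forget-last (last S)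
    (trans (sym (last-map forget S)) (trans (cong last (sym (underlying≡map S))) (R1⇒ends-east _ 0<a path r1)))
  where
  forget-last : ∀ m → Maybe.map forget m ≡ just E → m ≡ just east
  forget-last (just east) _ = refl

module _ {a b : ℕ} (k : ℕ) (0<a : 0 < a) (cop : Coprime a b) where

  labeled-unique-skeletal-shift : ∀ Q → IsLabeledPath a b Q → last Q ≡ just east →
                                  ∃! (λ S → SkeletalLabeled a b k S × IsShiftOf S Q)
  labeled-unique-skeletal-shift Q labeled last≡east =
    rotate v Q , (skeletal-labeled , v , ℕ.<⇒≤ v<|Q| , refl) , unique
    where
    open Skeleton k 0<a cop (underlying Q) (proj₁ labeled)
    v : ℕ
    v = proj₁ skeletal-rotation
    v<n : v < length (underlying Q)
    v<n = proj₁ (proj₂ skeletal-rotation)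
    v<|Q| : v < length Q
    v<|Q| = subst (v <_) (length-underlying Q) v<n
    skeletal-labeled : SkeletalLabeled a b k (rotate v Q)
    skeletal-labeled = rotate-labeled last≡east (ℕ.<⇒≤ v<|Q|) labeled ,
                       subst (Skeletal a b k) (sym (underlying-rotate v Q)) (proj₂ (proj₂ skeletal-rotation))
    unique : ∀ S → SkeletalLabeled a b k S × IsShiftOf S Q → S ≡ rotate v Q
    unique S ((_ , skel-S) , shift) =
      let u , u<|Q| , S≡ = shift-index (subst (0 <_) (length-underlying Q) 0<n) shift
          u<n = subst (u <_) (sym (length-underlying Q)) u<|Q|
          skel-u = subst (Skeletal a b k) (trans (cong underlying S≡) (underlying-rotate u Q)) skel-S
      in trans S≡ (cong (λ i → rotate i Q) (skeletal-index-unique u<n v<n skel-u (proj₂ (proj₂ skeletal-rotation))))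

-- Counting labeled paths

-- Insert a north step labeled l just before the x-th east step of Q, counting from 0.
insertNorth : ℕ → ℕ → List LStep → List LStep
insertNorth l x       []            = []
insertNorth l x       (north m ∷ Q) = north m ∷ insertNorth l x Q
insertNorth l zero    (east ∷ Q)    = north l ∷ east ∷ Q
insertNorth l (suc x) (east ∷ Q)    = east ∷ insertNorth l x Q

east-split : ∀ {x} Q → x < #east Q → ∃[ A ] ∃[ B ] Q ≡ A ++ east ∷ B × #east A ≡ x
east-split {zero}  (east ∷ Q)    _         = [] , Q , refl , refl
east-split {suc x} (east ∷ Q)    (s≤s x<e) with east-split Q x<e
... | A , B , refl , refl = east ∷ A , B , refl , refl
east-split         (north m ∷ Q) x<e with east-split Q x<e
... | A , B , refl , refl = north m ∷ A , B , refl , refl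

insertNorth-++ : ∀ l A B → insertNorth l (#east A) (A ++ east ∷ B) ≡ A ++ north l ∷ east ∷ B
insertNorth-++ l []            B = refl
insertNorth-++ l (east ∷ A)    B = cong (east ∷_) (insertNorth-++ l A B)
insertNorth-++ l (north m ∷ A) B = cong (north m ∷_) (insertNorth-++ l A B)

module _ (l : ℕ) {x : ℕ} (Q : List LStep) (x<e : x < #east Q) where

  insertNorth-split : ∃[ A ] ∃[ B ] Q ≡ A ++ east ∷ B × insertNorth l x Q ≡ A ++ north l ∷ east ∷ B
  insertNorth-split with east-split Q x<e
  ... | A , B , refl , refl = A , B , refl , insertNorth-++ l A B

  #east-insertNorth : #east (insertNorth l x Q) ≡ #east Q
  #east-insertNorth with insertNorth-split
  ... | A , B , refl , ins≡ rewrite ins≡ = trans (#east-++ A (north l ∷ east ∷ B)) (sym (#east-++ A (east ∷ B)))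

  #north-insertNorth : #north (insertNorth l x Q) ≡ suc (#north Q)
  #north-insertNorth with insertNorth-split
  ... | A , B , refl , ins≡ rewrite ins≡ | #north-++ A (north l ∷ east ∷ B) | #north-++ A (east ∷ B) =
    ℕ.+-suc (#north A) (#north B)

  labels-insertNorth : labels (insertNorth l x Q) ↭ l ∷ labels Q
  labels-insertNorth with insertNorth-split
  ... | A , B , refl , ins≡ rewrite ins≡ | labels-++ A (north l ∷ east ∷ B) | labels-++ A (east ∷ B) =
    ↭.shift l (labels A) (labels B)

  last-insertNorth : last (insertNorth l x Q) ≡ last Q
  last-insertNorth with insertNorth-split
  ... | A , B , refl , ins≡ rewrite ins≡ = trans (last-++ A (north l) (east ∷ B)) (sym (last-++ A east B))

head-insertNorth : ∀ l x Q → head (insertNorth l x Q) ≡ head Q ⊎ head (insertNorth l x Q) ≡ just (north l)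
head-insertNorth l x       []            = inj₁ refl
head-insertNorth l x       (north m ∷ Q) = inj₁ refl
head-insertNorth l zero    (east ∷ Q)    = inj₂ refl
head-insertNorth l (suc x) (east ∷ Q)    = inj₁ refl

linked-insertNorth : ∀ {l} x Q → All (_< l) (labels Q) → Linked NorthAscending Q →
                     Linked NorthAscending (insertNorth l x Q)
linked-insertNorth x       []            _             _      = []
linked-insertNorth zero    (east ∷ Q)    _             linked = tt ∷ linked
linked-insertNorth (suc x) (east ∷ Q)    below         linked =
  connected-from (λ _ → tt) _ Linked.∷′ linked-insertNorth x Q below (Linked.tail linked)
linked-insertNorth {l} x (north m ∷ Q) (m<l All.∷ below) linked =
  head-ok (head-insertNorth l x Q) Linked.∷′ linked-insertNorth x Q below (Linked.tail linked)
  where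
  head-ok : head (insertNorth l x Q) ≡ head Q ⊎ head (insertNorth l x Q) ≡ just (north l) →
            Connected NorthAscending (just (north m)) (head (insertNorth l x Q))
  head-ok (inj₁ same)  = subst (Connected NorthAscending (just (north m))) (sym same) (Linked.head′ linked)
  head-ok (inj₂ top)   = subst (Connected NorthAscending (just (north m))) (sym top) (just m<l)

∉-labels-tail : ∀ {l} y A → l ∉ labels (y ∷ A) → l ∉ labels A
∉-labels-tail east      A l∉ = l∉
∉-labels-tail (north m) A l∉ = l∉ ∘ there

north-label-split : ∀ {l} A A′ {R R′} → l ∉ labels A → l ∉ labels A′ →
                    A ++ north l ∷ R ≡ A′ ++ north l ∷ R′ → A ≡ A′ × R ≡ R′
north-label-split []      []       _   _    same = refl , ∷-injectiveʳ same
north-label-split []      (y ∷ A′) _   l∉A′ refl = contradiction (here refl) l∉A′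
north-label-split (y ∷ A) []       l∉A _    refl = contradiction (here refl) l∉A
north-label-split (y ∷ A) (y′ ∷ A′) l∉A l∉A′ same with ∷-injective same
... | refl , same′ =
  Product.map₁ (cong (y ∷_)) (north-label-split A A′ (∉-labels-tail y A l∉A) (∉-labels-tail y A′ l∉A′) same′)

insertNorth-injective : ∀ {l x x′ Q Q′} → x < #east Q → x′ < #east Q′ → l ∉ labels Q → l ∉ labels Q′ →
                        insertNorth l x Q ≡ insertNorth l x′ Q′ → x ≡ x′ × Q ≡ Q′
insertNorth-injective {l} {Q = Q} {Q′} x<e x′<e l∉Q l∉Q′ same with east-split Q x<e | east-split Q′ x′<e
... | A , B , refl , refl | A′ , B′ , refl , refl
  with north-label-split A A′ (prefix-∉ A B l∉Q) (prefix-∉ A′ B′ l∉Q′)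
         (trans (sym (insertNorth-++ l A B)) (trans same (insertNorth-++ l A′ B′)))
  where
  prefix-∉ : ∀ A B → l ∉ labels (A ++ east ∷ B) → l ∉ labels A
  prefix-∉ A B l∉ l∈A = l∉ (subst (l ∈_) (sym (labels-++ A (east ∷ B))) (∈-++⁺ˡ l∈A))
... | refl , refl = refl , refl

labelRange-suc : ∀ b → map suc (upTo (suc b)) ↭ suc b ∷ map suc (upTo b)
labelRange-suc b = begin
  map suc (upTo (suc b))          ≡⟨ cong (map suc) (upTo-∷ʳ b) ⟨
  map suc (upTo b ++ b ∷ [])      ≡⟨ map-++ suc (upTo b) (b ∷ []) ⟩
  map suc (upTo b) ++ suc b ∷ []  ↭⟨ ↭.++-comm (map suc (upTo b)) (suc b ∷ []) ⟩
  suc b ∷ map suc (upTo b)        ∎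
  where open PermutationReasoning

bounded-by-labelRange : ∀ {b ls} → ls ↭ map suc (upTo b) → All (_≤ b) ls
bounded-by-labelRange {b} perm = All.tabulate λ l∈ → bound (↭.∈-resp-↭ perm l∈)
  where
  bound : ∀ {l} → l ∈ map suc (upTo b) → l ≤ b
  bound l∈ with ∈-map⁻ suc l∈
  ... | i , i∈ , refl = ∈-upTo⁻ i∈

suc-∉-labelRange : ∀ {b ls} → ls ↭ map suc (upTo b) → suc b ∉ ls
suc-∉-labelRange perm top∈ = ℕ.<-irrefl refl (All.lookup (bounded-by-labelRange perm) top∈)

north-split : ∀ {l} Q → l ∈ labels Q → ∃[ A ] ∃[ R ] Q ≡ A ++ north l ∷ R
north-split (east ∷ Q)    l∈         with north-split Q l∈
... | A , R , refl = east ∷ A , R , refl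
north-split (north m ∷ Q) (here refl) = [] , Q , refl
north-split (north m ∷ Q) (there l∈) with north-split Q l∈
... | A , R , refl = north m ∷ A , R , refl

linked-removeNorth : ∀ {l} A B → Linked NorthAscending (A ++ north l ∷ east ∷ B) → Linked NorthAscending (A ++ east ∷ B)
linked-removeNorth A B linked =
  Linked.++⁺ (linked-++⁻ˡ A linked) (connected-to ascending-before-east (last A)) (Linked.tail (linked-++⁻ʳ A linked))

EastEndedLabeled : ℕ → ℕ → List LStep → Set
EastEndedLabeled a b Q = IsLabeledPath a b Q × last Q ≡ just east

insertNorth-labeled : ∀ {a b x Q} → x < a → EastEndedLabeled a b Q → EastEndedLabeled a (suc b) (insertNorth (suc b) x Q)
insertNorth-labeled {a} {b} {x} {Q} x<a (((#E≡a , #N≡b) , perm , ascending) , last≡east) =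
  ((trans (#east-insertNorth (suc b) Q x<e) #E≡a , trans (#north-insertNorth (suc b) Q x<e) (cong suc #N≡b)) ,
   ↭-trans (labels-insertNorth (suc b) Q x<e) (↭-trans (prep (suc b) perm) (↭-sym (labelRange-suc b))) ,
   linked⇒ascending (linked-insertNorth x Q (All.map s≤s (bounded-by-labelRange perm)) (ascending⇒linked Q ascending))) ,
  trans (last-insertNorth (suc b) Q x<e) last≡east
  where
  x<e : x < #east Q
  x<e = subst (x <_) (sym #E≡a) x<a

top-label-before-east : ∀ {a b Q} → EastEndedLabeled a (suc b) Q → ∃[ A ] ∃[ B ] Q ≡ A ++ north (suc b) ∷ east ∷ B
top-label-before-east {b = b} {Q} ((_ , perm , ascending) , last≡east)
  with north-split Q (↭.∈-resp-↭ (↭-sym perm) (↭.∈-resp-↭ (↭-sym (labelRange-suc b)) (here refl)))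
... | A , []          , refl with () ← trans (sym (last-++ A (north (suc b)) [])) last≡east
... | A , east ∷ B    , refl = A , B , refl
... | A , north l ∷ R , refl = contradiction l≤b+1 (ℕ.<⇒≱ b+1<l)
  where
  b+1<l : suc b < l
  b+1<l = Linked.head (linked-++⁻ʳ A (ascending⇒linked _ ascending))
  l≤b+1 : l ≤ suc b
  l≤b+1 = All.lookup (bounded-by-labelRange perm)
            (subst (l ∈_) (sym (labels-++ A (north (suc b) ∷ north l ∷ R))) (∈-++⁺ʳ (labels A) (there (here refl))))

removeTop : ∀ {a b Q} → EastEndedLabeled a (suc b) Q →
            ∃[ x ] ∃[ Q′ ] x < a × Q ≡ insertNorth (suc b) x Q′ × EastEndedLabeled a b Q′
removeTop {a} {b} Q-labeled@(((#E≡a , #N≡b+1) , perm , ascending) , last≡east) with top-label-before-east Q-labeled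
... | A , B , refl =
  #east A , A ++ east ∷ B , subst (#east A <_) #E′≡a x<e , sym inserted ,
  ((#E′≡a , ℕ.suc-injective (trans (sym (#north-insertNorth (suc b) (A ++ east ∷ B) x<e)) (trans (cong #north inserted) #N≡b+1))) ,
   ↭.drop-∷ (↭-trans (↭-sym (labels-insertNorth (suc b) (A ++ east ∷ B) x<e))
                     (↭-trans (↭-reflexive (cong labels inserted)) (↭-trans perm (labelRange-suc b)))) ,
   linked⇒ascending (linked-removeNorth A B (ascending⇒linked _ ascending))) ,
  trans (sym (last-insertNorth (suc b) (A ++ east ∷ B) x<e)) (trans (cong last inserted) last≡east)
  where
  inserted : insertNorth (suc b) (#east A) (A ++ east ∷ B) ≡ A ++ north (suc b) ∷ east ∷ B
  inserted = insertNorth-++ (suc b) A B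
  x<e : #east A < #east (A ++ east ∷ B)
  x<e = subst (#east A <_) (sym (#east-++ A (east ∷ B))) (ℕ.m<m+n (#east A) (s≤s z≤n))
  #E′≡a : #east (A ++ east ∷ B) ≡ a
  #E′≡a = trans (sym (#east-insertNorth (suc b) (A ++ east ∷ B) x<e)) (trans (cong #east inserted) #E≡a)

eastEndedLabeledPaths : ℕ → ℕ → List (List LStep)
eastEndedLabeledPaths a zero    = replicate a east ∷ []
eastEndedLabeledPaths a (suc b) =
  map (uncurry (insertNorth (suc b))) (cartesianProduct (upTo a) (eastEndedLabeledPaths a b))

all-east-labeled : ∀ {a} → 0 < a → EastEndedLabeled a 0 (replicate a east)
all-east-labeled {a} 0<a =
  ((#E-all-east a , #N-all-east a) , ↭-reflexive (labels-all-east a) , linked⇒ascending (linked-all-east a)) ,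
  last-all-east 0<a
  where
  #E-all-east : ∀ a → #east (replicate a east) ≡ a
  #E-all-east zero    = refl
  #E-all-east (suc a) = cong suc (#E-all-east a)
  #N-all-east : ∀ a → #north (replicate a east) ≡ 0
  #N-all-east zero    = refl
  #N-all-east (suc a) = #N-all-east a
  labels-all-east : ∀ a → labels (replicate a east) ≡ []
  labels-all-east zero    = refl
  labels-all-east (suc a) = labels-all-east a
  linked-all-east : ∀ a → Linked NorthAscending (replicate a east)
  linked-all-east zero          = []
  linked-all-east (suc zero)    = [-]
  linked-all-east (suc (suc a)) = tt ∷ linked-all-east (suc a)
  last-all-east : ∀ {a} → 0 < a → last (replicate a east) ≡ just east
  last-all-east {suc zero}    _ = refl
  last-all-east {suc (suc a)} _ = last-all-east {suc a} (s≤s z≤n)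

no-north⇒all-east : ∀ Q → #north Q ≡ 0 → Q ≡ replicate (#east Q) east
no-north⇒all-east []         _  = refl
no-north⇒all-east (east ∷ Q) #N≡0 = cong (east ∷_) (no-north⇒all-east Q #N≡0)

module _ {a : ℕ} (0<a : 0 < a) where

  ∈-eastEnded⁻ : ∀ b {Q} → Q ∈ eastEndedLabeledPaths a b → EastEndedLabeled a b Q
  ∈-eastEnded⁻ zero    (here refl) = all-east-labeled 0<a
  ∈-eastEnded⁻ (suc b) Q∈ with ∈-map⁻ (uncurry (insertNorth (suc b))) Q∈
  ... | (x , Q′) , p∈ , refl with ∈-cartesianProduct⁻ (upTo a) (eastEndedLabeledPaths a b) p∈
  ...   | x∈ , Q′∈ = insertNorth-labeled (∈-upTo⁻ x∈) (∈-eastEnded⁻ b Q′∈)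

  ∈-eastEnded⁺ : ∀ b {Q} → EastEndedLabeled a b Q → Q ∈ eastEndedLabeledPaths a b
  ∈-eastEnded⁺ zero    {Q} (((#E≡a , #N≡0) , _) , _) =
    here (trans (no-north⇒all-east Q #N≡0) (cong (λ m → replicate m east) #E≡a))
  ∈-eastEnded⁺ (suc b) Q-labeled with removeTop Q-labeled
  ... | x , Q′ , x<a , refl , Q′-labeled =
    ∈-map⁺ (uncurry (insertNorth (suc b))) (∈-cartesianProduct⁺ (∈-upTo⁺ x<a) (∈-eastEnded⁺ b Q′-labeled))

  eastEnded-unique : ∀ b → Unique (eastEndedLabeledPaths a b)
  eastEnded-unique zero    = All.[] ∷ []
  eastEnded-unique (suc b) =
    Unique-map-injectiveOn (uncurry (insertNorth (suc b)))
      (Unique.cartesianProduct⁺ (Unique.upTo⁺ a) (eastEnded-unique b)) injective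
    where
    bounds : ∀ {x Q} → (x , Q) ∈ cartesianProduct (upTo a) (eastEndedLabeledPaths a b) → x < #east Q × suc b ∉ labels Q
    bounds p∈ with ∈-cartesianProduct⁻ (upTo a) (eastEndedLabeledPaths a b) p∈
    ... | x∈ , Q∈ with ∈-eastEnded⁻ b Q∈
    ...   | ((#E≡a , _) , perm , _) , _ = subst (_ <_) (sym #E≡a) (∈-upTo⁻ x∈) , suc-∉-labelRange perm
    injective : ∀ {p q} → p ∈ cartesianProduct (upTo a) (eastEndedLabeledPaths a b) →
                q ∈ cartesianProduct (upTo a) (eastEndedLabeledPaths a b) →
                uncurry (insertNorth (suc b)) p ≡ uncurry (insertNorth (suc b)) q → p ≡ q
    injective p∈ q∈ same with bounds p∈ | bounds q∈
    ... | x<e , top∉ | x′<e , top∉′ = ×-≡,≡→≡ (insertNorth-injective x<e x′<e top∉ top∉′ same)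

length-eastEnded : ∀ a b → length (eastEndedLabeledPaths a b) ≡ a ^ b
length-eastEnded a zero    = refl
length-eastEnded a (suc b) = begin
  length (map (uncurry (insertNorth (suc b))) (cartesianProduct (upTo a) (eastEndedLabeledPaths a b)))
    ≡⟨ length-map (uncurry (insertNorth (suc b))) (cartesianProduct (upTo a) (eastEndedLabeledPaths a b)) ⟩
  length (cartesianProduct (upTo a) (eastEndedLabeledPaths a b))
    ≡⟨ length-cartesianProduct (upTo a) (eastEndedLabeledPaths a b) ⟩
  length (upTo a) * length (eastEndedLabeledPaths a b)
    ≡⟨ cong₂ _*_ (length-upTo a) (length-eastEnded a b) ⟩
  a * a ^ b ∎
  where open ≡-Reasoning

-- The number of steps of Q up to and including its (t + 1)-th east step.
afterEast : ℕ → List LStep → ℕ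
afterEast t       []            = 0
afterEast t       (north _ ∷ Q) = suc (afterEast t Q)
afterEast zero    (east ∷ Q)    = 1
afterEast (suc t) (east ∷ Q)    = suc (afterEast t Q)

afterEast-++ : ∀ A B → afterEast (#east A) (A ++ east ∷ B) ≡ suc (length A)
afterEast-++ []            B = refl
afterEast-++ (east ∷ A)    B = cong suc (afterEast-++ A B)
afterEast-++ (north _ ∷ A) B = cong suc (afterEast-++ A B)

cut-at-east : ∀ {p} S → 0 < p → p ≤ length S → last (rotate p S) ≡ just east →
              ∃[ t ] t < #east S × afterEast t S ≡ p
cut-at-east S 0<p p≤n last≡east with ending-split S p≤n (trans (sym (last-rotate S 0<p p≤n)) last≡east)
... | X , Y , refl , |X|+1≡p =
  #east X , subst (#east X <_) (sym (#east-++ X (east ∷ Y))) (ℕ.m<m+n (#east X) (s≤s z≤n)) ,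
  trans (afterEast-++ X Y) |X|+1≡p

record EastCut (t : ℕ) (Q : List LStep) : Set where
  field
    positive     : 0 < afterEast t Q
    bounded      : afterEast t Q ≤ length Q
    ends-east    : last (take (afterEast t Q) Q) ≡ just east
    easts-before : #east (take (afterEast t Q) Q) ≡ suc t

eastCut : ∀ {t} Q → t < #east Q → EastCut t Q
eastCut Q t<e with east-split Q t<e
... | X , Y , refl , refl = record
  { positive     = subst (0 <_) (sym p≡) (s≤s z≤n)
  ; bounded      = subst (_≤ length (X ++ east ∷ Y)) (sym p≡)
                          (subst (length X <_) (sym (length-++ X)) (ℕ.m<m+n (length X) (s≤s z≤n)))
  ; ends-east    = at-cut (λ C → last C ≡ just east) (last-++ X east [])
  ; easts-before = at-cut (λ C → #east C ≡ suc (#east X)) (trans (#east-++ X (east ∷ [])) (ℕ.+-comm (#east X) 1))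
  }
  where
  p≡ : afterEast (#east X) (X ++ east ∷ Y) ≡ suc (length X)
  p≡ = afterEast-++ X Y
  at-cut : (F : List LStep → Set) → F (X ++ east ∷ []) → F (take (afterEast (#east X) (X ++ east ∷ Y)) (X ++ east ∷ Y))
  at-cut F F-cut = subst (λ p → F (take p (X ++ east ∷ Y))) (sym p≡) (subst F (sym (take-suc-length-++ X east Y)) F-cut)

east-ended-shift : ∀ {x s} → 0 < length x → last x ≡ just east → IsShiftOf s x →
                   ∃[ t ] t < #east s × x ≡ rotate (afterEast t s) s
east-ended-shift {x} 0<|x| last≡east shift with shift-index 0<|x| shift
... | v , v<|x| , refl
  with cut-at-east (rotate v x) (ℕ.m<n⇒0<n∸m v<|x|) p≤n (trans (cong last (rotate-inverse x v≤|x|)) last≡east)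
  where
  v≤|x| : v ≤ length x
  v≤|x| = ℕ.<⇒≤ v<|x|
  p≤n : length x ∸ v ≤ length (rotate v x)
  p≤n = subst (length x ∸ v ≤_) (sym (length-rotate v x)) (ℕ.m∸n≤m (length x) v)
... | t , t<e , cut≡ =
  t , t<e , trans (sym (rotate-inverse x (ℕ.<⇒≤ v<|x|))) (cong (λ p → rotate p (rotate v x)) (sym cut≡))

module _ {a b : ℕ} (k : ℕ) (0<a : 0 < a) (cop : Coprime a b) where

  skeletalLabeledPaths : List (List LStep)
  skeletalLabeledPaths = filter (skeletal? a b k ∘ underlying) (eastEndedLabeledPaths a b)

  ∈-skeletalLabeledPaths : ∀ S → (S ∈ skeletalLabeledPaths) ⇔ SkeletalLabeled a b k S
  ∈-skeletalLabeledPaths S = mk⇔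
    (Product.map₁ (proj₁ ∘ ∈-eastEnded⁻ 0<a b) ∘ ∈-filter⁻ (skeletal? a b k ∘ underlying))
    (λ (labeled , skel) → ∈-filter⁺ (skeletal? a b k ∘ underlying)
                            (∈-eastEnded⁺ 0<a b (labeled , R1⇒labeled-ends-east S 0<a labeled (proj₁ skel))) skel)

  skeletalLabeledPaths-unique : Unique skeletalLabeledPaths
  skeletalLabeledPaths-unique = Unique.filter⁺ (skeletal? a b k ∘ underlying) (eastEnded-unique 0<a b)

  private
    rotate-at-cut : List LStep → ℕ → List LStep
    rotate-at-cut s t = rotate (afterEast t s) s

    members-end-east : ∀ {s} → s ∈ skeletalLabeledPaths → SkeletalLabeled a b k s × last s ≡ just east
    members-end-east {s} s∈ with Equivalence.to (∈-skeletalLabeledPaths s) s∈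
    ... | labeled , skel = (labeled , skel) , R1⇒labeled-ends-east s 0<a labeled (proj₁ skel)

    rotate-at-cut-eastEnded : ∀ {s t} → s ∈ skeletalLabeledPaths → t < a → EastEndedLabeled a b (rotate-at-cut s t)
    rotate-at-cut-eastEnded {s} {t} s∈ t<a =
      let ((labeled , _) , last≡east) = members-end-east s∈
          cut = eastCut s (subst (t <_) (sym (proj₁ (proj₁ labeled))) t<a)
      in rotate-labeled last≡east (EastCut.bounded cut) labeled ,
         trans (last-rotate s (EastCut.positive cut) (EastCut.bounded cut)) (EastCut.ends-east cut)

    same-skeleton : ∀ {s s′ t t′} → s ∈ skeletalLabeledPaths → s′ ∈ skeletalLabeledPaths → t < a → t′ < a →
                    rotate-at-cut s t ≡ rotate-at-cut s′ t′ → s ≡ s′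
    same-skeleton {s} {s′} {t} {t′} s∈ s′∈ t<a t′<a same =
      let x-labeled , x-last = rotate-at-cut-eastEnded s∈ t<a
          _ , _ , unique = labeled-unique-skeletal-shift k 0<a cop (rotate-at-cut s t) x-labeled x-last
          (labeled , skel) , _ = members-end-east s∈
          (labeled′ , skel′) , _ = members-end-east s′∈
          cut = eastCut s (subst (t <_) (sym (proj₁ (proj₁ labeled))) t<a)
          cut′ = eastCut s′ (subst (t′ <_) (sym (proj₁ (proj₁ labeled′))) t′<a)
          shift = shift-sym (afterEast t s , EastCut.bounded cut , refl)
          shift′ = subst (IsShiftOf s′) (sym same) (shift-sym (afterEast t′ s′ , EastCut.bounded cut′ , refl))
      in trans (unique s ((labeled , skel) , shift)) (sym (unique s′ ((labeled′ , skel′) , shift′)))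

    same-cut : ∀ {s t t′} → s ∈ skeletalLabeledPaths → t < a → t′ < a →
               rotate-at-cut s t ≡ rotate-at-cut s t′ → t ≡ t′
    same-cut {s} {t} {t′} s∈ t<a t′<a same =
      let (labeled , _) , _ = members-end-east s∈
          cut = eastCut s (subst (t <_) (sym (proj₁ (proj₁ labeled))) t<a)
          cut′ = eastCut s (subst (t′ <_) (sym (proj₁ (proj₁ labeled))) t′<a)
          |s|≡ = sym (length-underlying s)
          p≡p′ = Skeleton.rotate-injective⁺ k 0<a cop (underlying s) (proj₁ labeled)
                   (EastCut.positive cut) (EastCut.positive cut′)
                   (subst (afterEast t s ≤_) |s|≡ (EastCut.bounded cut))
                   (subst (afterEast t′ s ≤_) |s|≡ (EastCut.bounded cut′))
                   (trans (sym (underlying-rotate (afterEast t s) s))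
                          (trans (cong underlying same) (underlying-rotate (afterEast t′ s) s)))
      in ℕ.suc-injective (trans (sym (EastCut.easts-before cut))
                         (trans (cong (λ p → #east (take p s)) p≡p′) (EastCut.easts-before cut′)))

  eastEnded≡skeletalLabeled*a : length (eastEndedLabeledPaths a b) ≡ length skeletalLabeledPaths * a
  eastEnded≡skeletalLabeled*a =
    length-orbits rotate-at-cut (eastEnded-unique 0<a b) skeletalLabeledPaths-unique cover into injective
    where
    into : ∀ {s t} → s ∈ skeletalLabeledPaths → t < a → rotate-at-cut s t ∈ eastEndedLabeledPaths a b
    into s∈ t<a = ∈-eastEnded⁺ 0<a b (rotate-at-cut-eastEnded s∈ t<a)

    cover : ∀ {x} → x ∈ eastEndedLabeledPaths a b →
            ∃[ s ] ∃[ t ] s ∈ skeletalLabeledPaths × t < a × x ≡ rotate-at-cut s t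
    cover {x} x∈ =
      let labeled , last≡east = ∈-eastEnded⁻ 0<a b x∈
          s , (skel , shift) , _ = labeled-unique-skeletal-shift k 0<a cop x labeled last≡east
          0<|x| = subst (0 <_) (length-underlying x) (Skeleton.0<n k 0<a cop (underlying x) (proj₁ labeled))
          t , t<e , x≡ = east-ended-shift 0<|x| last≡east shift
      in s , t , Equivalence.from (∈-skeletalLabeledPaths s) skel , subst (t <_) (proj₁ (proj₁ (proj₁ skel))) t<e , x≡

    injective : ∀ {s s′ t t′} → s ∈ skeletalLabeledPaths → s′ ∈ skeletalLabeledPaths → t < a → t′ < a →
                rotate-at-cut s t ≡ rotate-at-cut s′ t′ → s ≡ s′ × t ≡ t′
    injective {t′ = t′} s∈ s′∈ t<a t′<a same =
      let s≡s′ = same-skeleton s∈ s′∈ t<a t′<a same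
      in s≡s′ , same-cut s∈ t<a t′<a (trans same (cong (λ s → rotate-at-cut s t′) (sym s≡s′)))

*-cancel-^ : ∀ {a L} n → 0 < a → L * a ≡ a ^ suc n → L ≡ a ^ n
*-cancel-^ {a} {L} n 0<a L*a≡ = ℕ.*-cancelʳ-≡ L (a ^ n) a {{>-nonZero 0<a}} (trans L*a≡ (ℕ.*-comm a (a ^ n)))

theorem1p8 : (a b k : ℕ) → 0 < a → 0 < b → Coprime a b → k < b →
    -- (a)
    ((P : List Step) → IsPath a b P →
       ∃! (λ Q → Skeletal a b k Q × IsShiftOf Q P))
    ×
    -- (b)  (number of k-skeletal paths) * (a+b) = binom(a+b, a)
    (Σ ℕ λ n → HasCount (λ Q → IsPath a b Q × Skeletal a b k Q) n
                × n * (a + b) ≡ (a + b) C a)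
    ×
    -- (c)
    ((Q : List LStep) → IsLabeledPath a b Q →
       (Σ (List LStep) λ R → Q ≡ R ++ (east ∷ [])) →
       ∃! (λ S → SkeletalLabeled a b k S × IsShiftOf S Q))
    ×
    -- (d)
    HasCount (SkeletalLabeled a b k) (a ^ (b ∸ 1))
theorem1p8 a (suc b) k 0<a _ cop _ =
  (λ P path → Skeleton.unique-skeletal-shift k 0<a cop P path) ,
  (length (skeletalPaths k 0<a cop) , skeletalPaths-count k 0<a cop ,
   trans (sym (paths≡skeletalPaths*[a+b] k 0<a cop)) (length-paths a (suc b))) ,
  (λ Q labeled (R , Q≡R∷ʳeast) →
     labeled-unique-skeletal-shift k 0<a cop Q labeled (trans (cong last Q≡R∷ʳeast) (last-++ R east []))) ,
  (skeletalLabeledPaths k 0<a cop , skeletalLabeledPaths-unique k 0<a cop , ∈-skeletalLabeledPaths k 0<a cop ,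
   *-cancel-^ b 0<a (trans (sym (eastEnded≡skeletalLabeled*a k 0<a cop)) (length-eastEnded a (suc b))))
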